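{- Let $n\ge4$ be an integer, $\mathrm{TH}_m=\binom{m+2}{3}$, and $\mathcal{TH}_n=\langle \mathrm{TH}_n,\mathrm{TH}_{n+1},\mathrm{TH}_{n+2},\mathrm{TH}_{n+3}\rangle$. With $k$ a non-negative integer, the Betti elements of $\mathcal{TH}_n$ are: (1) $2\binom{n+5}{4}$, $4\binom{n+4}{4}$ and $\frac{4}{3}\binom{n+3}{4}$, if $n=6k$; (2) $\frac{4}{3}\binom{n+5}{4}$, $2\binom{n+4}{4}$ and $4\binom{n+3}{4}$, if $n=6k+1$; (3) $2\binom{n+5}{4}$, $\frac{4}{3}\binom{n+4}{4}$ and $4\binom{n+3}{4}$, if $n=6k+2$; (4) $4\binom{n+5}{4}$, $2\binom{n+4}{4}$ and $\frac{4}{3}\binom{n+3}{4}$, if $n=6k+3$; (5) $\frac{4}{3}\binom{n+5}{4}$, $2\binom{n+4}{4}$ and $4\binom{n+3}{4}$, if $n=6k+4$; (6) $4\binom{n+5}{4}$, $\frac{4}{3}\binom{n+4}{4}$ and $2\binom{n+3}{4}$, if $n=6k+5$.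
   Context: Let $S$ be a numerical semigroup with minimal system of generators $\{n_1,\ldots,n_e\}$ and $\varphi:\mathbb N^e\to S$, $\varphi(u)=\sum_i u_in_i$. For $s\in S$, define on $\varphi^{ -1}(s)$ the relation $u\,\mathcal R_s\,v$ iff there is a chain $u=u_0,u_1,\ldots,u_r=v$ in $\varphi^{ -1}(s)$ with $u_i\cdot u_{i+1}\ne0$ (usual dot product) for all $i$; this is an equivalence relation. The Betti elements of $S$ are the $s\in S$ for which $\varphi^{ -1}(s)$ has more than one $\mathcal R_s$-class. -}

module Defs where

open import Data.Nat using (ℕ; _+_; _*_)
open import Data.Nat.Combinatorics using (_C_)
open import Data.Vec using (Vec; _∷_; []; zipWith; sum)
open import Data.Product using (∃; _×_; Σ)
open import Relation.Binary.PropositionalEquality using (_≡_; _≢_)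
open import Relation.Nullary using (¬_)
open import Relation.Binary.Construct.Closure.ReflexiveTransitive using (Star)

TH : ℕ → ℕ
TH m = (m + 2) C 3

gens : ℕ → Vec ℕ 4
gens n = TH n ∷ TH (n + 1) ∷ TH (n + 2) ∷ TH (n + 3) ∷ []

dot : Vec ℕ 4 → Vec ℕ 4 → ℕ
dot u v = sum (zipWith _*_ u v)

φ : ℕ → Vec ℕ 4 → ℕ
φ n u = dot u (gens n)

Link : ℕ → ℕ → Vec ℕ 4 → Vec ℕ 4 → Set
Link n s u v = φ n u ≡ s × φ n v ≡ s × dot u v ≢ 0

R : ℕ → ℕ → Vec ℕ 4 → Vec ℕ 4 → Set
R n s u v = φ n u ≡ s × φ n v ≡ s × Star (Link n s) u v

IsBetti : ℕ → ℕ → Set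
IsBetti n s = Σ (Vec ℕ 4) λ u → Σ (Vec ℕ 4) λ v →
  φ n u ≡ s × φ n v ≡ s × ¬ R n s u v

-- "s = (4/3) c", stated exactly over ℕ
FourThirds : ℕ → ℕ → Set
FourThirds s c = 3 * s ≡ 4 * c

-- For each residue of n modulo 6, the generators TH_n, …, TH_{n+3}, suitably ordered as n₁, …, n₄,
-- are telescopic: with d_i = gcd(n₁, …, n_i) and c_i = d_{i-1}/d_i, each c_i n_i lies in ⟨n₁, …, n_{i-1}⟩,
-- all data being polynomials in k.  In a telescopic semigroup every factorization of s can be moved
-- along R_s, by repeatedly trading c_i copies of n_i (i = 4, 3, 2) for an expression of c_i n_i in the
-- earlier generators, to the normal form whose i-th coordinate is below c_i; normal forms are unique
-- because c_i is coprime to n_i/d_i.  Such a trade is a link unless s = c_i n_i, so every other s has a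
-- single R_s-class.  Conversely, a factorization of c_i n_i that involves one of n_i, …, n₄ involves only
-- those, so the factorization by c_i copies of n_i is not R-related to the expression of c_i n_i in
-- n₁, …, n_{i-1}.  Polynomial identities finally turn c_i n_i into the binomial expressions of the statement.

module Submission where

open import Defs
open import Data.Nat
open import Data.Nat.Properties
open import Data.Nat.Divisibility using (_∣_; divides; ∣m+n∣m⇒∣n; n∣m*n; ∣-trans; ∣1⇒≡1)
open import Data.Nat.Coprimality as Coprimality using (Coprime; coprime-divisor)
open import Data.Nat.Combinatorics using (_C_; nC1≡n; nCk+nC[k+1]≡[n+1]C[k+1])
open import Data.Nat.Induction using (<-wellFounded)
open import Data.Nat.Tactic.RingSolver using (solve-∀; solve)
open import Data.List.Base using ([_])
open import Data.Vec.Base using (Vec; _∷_; []; zipWith; sum)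
open import Data.Vec.Properties using (zipWith-comm)
open import Data.Product using (Σ; Σ-syntax; ∃-syntax; _×_; _,_; proj₁; proj₂)
open import Data.Sum using (_⊎_; inj₁; inj₂)
open import Data.Sum.Function.Propositional using (_⊎-⇔_)
open import Data.Empty using (⊥-elim)
open import Function.Base using (id; _∘_; flip)
open import Function.Bundles using (_⇔_; mk⇔)
import Function.Properties.Equivalence as ⇔
open import Induction.WellFounded using (Acc; acc)
open import Relation.Nullary using (¬_; yes; no)
open import Relation.Binary.Definitions using (Symmetric)
open import Relation.Binary.PropositionalEquality hiding ([_])
open import Relation.Binary.Construct.Closure.ReflexiveTransitive
  using (Star; ε; _◅_; _◅◅_; fold; gmap; reverse)

ℕ⁴ : Set
ℕ⁴ = Vec ℕ 4

-- Link, R and IsBetti of Defs for an arbitrary generator vector g; IsBetti n is IsBetti′ (gens n).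
Link′ : ℕ⁴ → ℕ → ℕ⁴ → ℕ⁴ → Set
Link′ g s u v = dot u g ≡ s × dot v g ≡ s × dot u v ≢ 0

R′ : ℕ⁴ → ℕ → ℕ⁴ → ℕ⁴ → Set
R′ g s u v = dot u g ≡ s × dot v g ≡ s × Star (Link′ g s) u v

IsBetti′ : ℕ⁴ → ℕ → Set
IsBetti′ g s = Σ ℕ⁴ λ u → Σ ℕ⁴ λ v → dot u g ≡ s × dot v g ≡ s × ¬ R′ g s u v

_+ᵛ_ : ℕ⁴ → ℕ⁴ → ℕ⁴
_+ᵛ_ = zipWith _+_

0ᵛ : ℕ⁴
0ᵛ = 0 ∷ 0 ∷ 0 ∷ 0 ∷ []

dot-zeroˡ : ∀ g → dot 0ᵛ g ≡ 0
dot-zeroˡ (_ ∷ _ ∷ _ ∷ _ ∷ []) = refl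

dot-comm : ∀ u v → dot u v ≡ dot v u
dot-comm u v = cong sum (zipWith-comm *-comm u v)

dot-+ᵛ : ∀ u w g → dot (u +ᵛ w) g ≡ dot u g + dot w g
dot-+ᵛ (a ∷ b ∷ c ∷ d ∷ []) (a′ ∷ b′ ∷ c′ ∷ d′ ∷ []) (x ∷ y ∷ z ∷ t ∷ []) =
  distrib a b c d a′ b′ c′ d′ x y z t
  where
  distrib : ∀ a b c d a′ b′ c′ d′ x y z t →
    (a + a′) * x + ((b + b′) * y + ((c + c′) * z + ((d + d′) * t + 0)))
      ≡ (a * x + (b * y + (c * z + (d * t + 0)))) + (a′ * x + (b′ * y + (c′ * z + (d′ * t + 0))))
  distrib = solve-∀

private
  x+w*y+w≡0⇒w≡0 : ∀ x y w → (x + w) * (y + w) ≡ 0 → w ≡ 0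
  x+w*y+w≡0⇒w≡0 x y w e with m*n≡0⇒m≡0∨n≡0 (x + w) e
  ... | inj₁ x+w≡0 = m+n≡0⇒n≡0 x x+w≡0
  ... | inj₂ y+w≡0 = m+n≡0⇒n≡0 y y+w≡0

  sum⁴≡0 : ∀ {p q r t} → p + (q + (r + (t + 0))) ≡ 0 → p ≡ 0 × q ≡ 0 × r ≡ 0 × t ≡ 0
  sum⁴≡0 {p} {q} {r} {t} e =
    m+n≡0⇒m≡0 p e , m+n≡0⇒m≡0 q e₁ , m+n≡0⇒m≡0 r e₂ , m+n≡0⇒m≡0 t (m+n≡0⇒n≡0 r e₂)
    where
    e₁ = m+n≡0⇒n≡0 p e
    e₂ = m+n≡0⇒n≡0 q e₁

dot-+ᵛ-≡0 : ∀ e f w → dot (e +ᵛ w) (f +ᵛ w) ≡ 0 → w ≡ 0ᵛ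
dot-+ᵛ-≡0 (a ∷ b ∷ c ∷ d ∷ []) (a′ ∷ b′ ∷ c′ ∷ d′ ∷ []) (x ∷ y ∷ z ∷ t ∷ []) e
  with sum⁴≡0 e
... | e₁ , e₂ , e₃ , e₄
  with x+w*y+w≡0⇒w≡0 a a′ x e₁ | x+w*y+w≡0⇒w≡0 b b′ y e₂
     | x+w*y+w≡0⇒w≡0 c c′ z e₃ | x+w*y+w≡0⇒w≡0 d d′ t e₄
... | refl | refl | refl | refl = refl

Link′-sym : ∀ g s → Symmetric (Link′ g s)
Link′-sym _ _ {u} {v} (hu , hv , u·v≢0) = hv , hu , u·v≢0 ∘ trans (dot-comm u v)

exchange-link : ∀ g {s} e f w → dot e g ≡ dot f g → dot (e +ᵛ w) g ≡ s → s ≢ dot e g →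
                Link′ g s (e +ᵛ w) (f +ᵛ w)
exchange-link g {s} e f w e≈f e+w↦s s≢e = e+w↦s , f+w↦s , e+w·f+w≢0
  where
  f+w↦s : dot (f +ᵛ w) g ≡ s
  f+w↦s = begin
    dot (f +ᵛ w) g    ≡⟨ dot-+ᵛ f w g ⟩
    dot f g + dot w g ≡⟨ cong (_+ dot w g) e≈f ⟨
    dot e g + dot w g ≡⟨ dot-+ᵛ e w g ⟨
    dot (e +ᵛ w) g    ≡⟨ e+w↦s ⟩
    s                 ∎
    where open ≡-Reasoning
  e+w·f+w≢0 : dot (e +ᵛ w) (f +ᵛ w) ≢ 0
  e+w·f+w≢0 orthogonal with dot-+ᵛ-≡0 e f w orthogonal
  ... | refl = s≢e (begin
    s                        ≡⟨ e+w↦s ⟨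
    dot (e +ᵛ 0ᵛ) g          ≡⟨ dot-+ᵛ e 0ᵛ g ⟩
    dot e g + dot 0ᵛ g       ≡⟨ cong (dot e g +_) (dot-zeroˡ g) ⟩
    dot e g + 0              ≡⟨ +-identityʳ (dot e g) ⟩
    dot e g                  ∎)
    where open ≡-Reasoning

Star-preserves : ∀ {A : Set} {T : A → A → Set} (P : A → Set) →
                 (∀ {x y} → T x y → P x → P y) → ∀ {x y} → Star T x y → P x → P y
Star-preserves P preserves = fold (λ x y → P x → P y) (λ t k → k ∘ preserves t) id

descend : ∀ {A : Set} {T : A → A → Set} (P Q : A → Set) (μ : A → ℕ) →
          (∀ x → P x → Q x ⊎ ∃[ y ] (T x y × P y × μ y < μ x)) →
          ∀ x → P x → ∃[ y ] (Star T x y × P y × Q y)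
descend {A} {T} P Q μ step x Px = go x Px (<-wellFounded (μ x))
  where
  go : ∀ x → P x → Acc _<_ (μ x) → ∃[ y ] (Star T x y × P y × Q y)
  go x Px (acc rec) with step x Px
  ... | inj₁ Qx = x , ε , Px , Qx
  ... | inj₂ (y , x⟶y , Py , μy<μx) with go y Py (rec μy<μx)
  ...   | z , y⟶*z , Pz , Qz = z , x⟶y ◅ y⟶*z , Pz , Qz

-- Opaque: unfolding this proof inside the `with`-analyses of TelescopicBetti makes type checking
-- exhaust memory.
opaque
  coprime-split : ∀ {c p} .{{_ : NonZero c}} → Coprime c p → ∀ W K L →
                  W * p + K * c ≡ L * c → ∃[ q ] W ≡ q * c × q * p + K ≡ L
  coprime-split {c} {p} c⊥p W K L e with coprime-divisor c⊥p c∣p*W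
    where
    c∣p*W : c ∣ p * W
    c∣p*W = ∣m+n∣m⇒∣n (divides L (trans (swap K c p W) e)) (n∣m*n K)
      where
      swap : ∀ K c p W → K * c + p * W ≡ W * p + K * c
      swap = solve-∀
  ... | divides q W≡qc = q , W≡qc , *-cancelʳ-≡ (q * p + K) L c (begin
    (q * p + K) * c   ≡⟨ distrib q p K c ⟩
    q * c * p + K * c ≡⟨ cong (λ w → w * p + K * c) W≡qc ⟨
    W * p + K * c     ≡⟨ e ⟩
    L * c             ∎)
    where
    open ≡-Reasoning
    distrib : ∀ q p K c → (q * p + K) * c ≡ q * c * p + K * c
    distrib = solve-∀

q*p+k≡p⇒q≡0⊎k≡0 : ∀ q p k → q * p + k ≡ p → q ≡ 0 ⊎ k ≡ 0
q*p+k≡p⇒q≡0⊎k≡0 zero    p k _ = inj₁ refl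
q*p+k≡p⇒q≡0⊎k≡0 (suc q) p k e =
  inj₂ (m+n≡0⇒n≡0 (q * p) (+-cancelˡ-≡ p (q * p + k) 0
    (trans (sym (+-assoc p (q * p) k)) (trans e (sym (+-identityʳ p))))))

private
  digit-gap≡0 : ∀ {c p} .{{_ : NonZero c}} → Coprime c p → ∀ a δ A B → a + δ < c →
                a * p + A * c ≡ (a + δ) * p + B * c → δ ≡ 0
  digit-gap≡0 {c} {p} c⊥p a δ A B a+δ<c e = multiple⇒δ≡0 (coprime-split c⊥p δ B A gap)
    where
    reassoc : ∀ a δ p X → a * p + (δ * p + X) ≡ (a + δ) * p + X
    reassoc = solve-∀
    gap : δ * p + B * c ≡ A * c
    gap = +-cancelˡ-≡ (a * p) (δ * p + B * c) (A * c) (trans (reassoc a δ p (B * c)) (sym e))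
    multiple⇒δ≡0 : ∃[ q ] δ ≡ q * c × q * p + B ≡ A → δ ≡ 0
    multiple⇒δ≡0 (zero , δ≡0 , _) = δ≡0
    multiple⇒δ≡0 (suc q , δ≡[1+q]c , _) =
      ⊥-elim (<⇒≱ (≤-<-trans (m≤n+m δ a) a+δ<c)
                  (subst (c ≤_) (sym δ≡[1+q]c) (m≤m+n c (q * c))))

digit-unique : ∀ {c p} .{{_ : NonZero c}} → Coprime c p → ∀ {a b} A B → a < c → b < c →
               a * p + A * c ≡ b * p + B * c → a ≡ b × A ≡ B
digit-unique {c} {p} c⊥p {a} {b} A B a<c b<c e = a≡b , A≡B
  where
  a≤b⇒a≡b : ∀ {a b} A B → a ≤ b → b < c → a * p + A * c ≡ b * p + B * c → a ≡ b
  a≤b⇒a≡b {a} A B a≤b b<c e with m≤n⇒∃[o]m+o≡n a≤b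
  ... | δ , refl = sym (trans (cong (a +_) (digit-gap≡0 c⊥p a δ A B b<c e)) (+-identityʳ a))
  a≡b : a ≡ b
  a≡b with ≤-total a b
  ... | inj₁ a≤b = a≤b⇒a≡b A B a≤b b<c e
  ... | inj₂ b≤a = sym (a≤b⇒a≡b B A b≤a a<c (sym e))
  A≡B : A ≡ B
  A≡B = *-cancelʳ-≡ A B c
          (+-cancelˡ-≡ (a * p) (A * c) (B * c) (trans e (cong (λ x → x * p + B * c) (sym a≡b))))

Bézout⇒coprime : ∀ m n x y → x * m ≡ y * n + 1 → Coprime m n
Bézout⇒coprime m n x y e {d} (d∣m , d∣n) =
  ∣1⇒≡1 (∣m+n∣m⇒∣n (subst (d ∣_) e (∣-trans d∣m (n∣m*n x))) (∣-trans d∣n (n∣m*n y)))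

Bézout⇒coprime′ : ∀ m n x y → x * m + 1 ≡ y * n → Coprime m n
Bézout⇒coprime′ m n x y e = Coprimality.sym (Bézout⇒coprime n m y x (sym e))

coprime-*ʳ : ∀ {c p q} → Coprime c p → Coprime c q → Coprime c (p * q)
coprime-*ʳ c⊥p c⊥q (d∣c , d∣pq) =
  c⊥q (d∣c , coprime-divisor (λ (e∣d , e∣p) → c⊥p (∣-trans e∣d d∣c , e∣p)) d∣pq)

-- Telescopic semigroups

-- Generators n₁, …, n₄ = c₂c₃c₄, p₂c₃c₄, p₃c₄, m₄ of a telescopic semigroup, with p₃ and m₄ defined
-- below so that c₂n₂ = p₂n₁, c₃n₃ = x₃₁n₁ + x₃₂n₂ and c₄n₄ = x₄₁n₁ + x₄₂n₂ + x₄₃n₃.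
record Telescopic : Set where
  field
    c₂ c₃ c₄ p₂ x₃₁ x₃₂ x₄₁ x₄₂ x₄₃ : ℕ
    ⦃ c₂≢0 ⦄ : NonZero c₂
    ⦃ c₃≢0 ⦄ : NonZero c₃
    ⦃ c₄≢0 ⦄ : NonZero c₄
    ⦃ p₂≢0 ⦄ : NonZero p₂
    ⦃ x₃₂≢0 ⦄ : NonZero x₃₂
    ⦃ x₄₃≢0 ⦄ : NonZero x₄₃
    c₂⊥p₂ : Coprime c₂ p₂
    c₃⊥p₃ : Coprime c₃ (x₃₂ * p₂ + x₃₁ * c₂)
    c₄⊥m₄ : Coprime c₄ (x₄₃ * (x₃₂ * p₂ + x₃₁ * c₂) + (x₄₂ * p₂ + x₄₁ * c₂) * c₃)

  -- value₂ a b = (a n₁ + b n₂)/(c₃c₄) and value₃ a b c = (a n₁ + b n₂ + c n₃)/c₄.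
  value₂ : ℕ → ℕ → ℕ
  value₂ a b = b * p₂ + a * c₂

  p₃ : ℕ
  p₃ = value₂ x₃₁ x₃₂

  value₃ : ℕ → ℕ → ℕ → ℕ
  value₃ a b c = c * p₃ + value₂ a b * c₃

  m₄ : ℕ
  m₄ = value₃ x₄₁ x₄₂ x₄₃

  n₁ n₂ n₃ n₄ : ℕ
  n₁ = c₂ * c₃ * c₄
  n₂ = p₂ * c₃ * c₄
  n₃ = p₃ * c₄
  n₄ = m₄

  generators : ℕ⁴
  generators = n₁ ∷ n₂ ∷ n₃ ∷ n₄ ∷ []

module TelescopicBetti (T : Telescopic) where
  open Telescopic T

  private
    g : ℕ⁴
    g = generators

    instance
      p₃≢0 : NonZero p₃
      p₃≢0 = ≢-nonZero (≢-nonZero⁻¹ (x₃₂ * p₂) ⦃ m*n≢0 x₃₂ p₂ ⦄ ∘ m+n≡0⇒m≡0 (x₃₂ * p₂))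

  horner : ∀ a b c d → dot (a ∷ b ∷ c ∷ d ∷ []) g ≡ d * m₄ + value₃ a b c * c₄
  horner a b c d = expand c₂ c₃ c₄ p₂ p₃ m₄ a b c d
    where
    expand : ∀ c₂ c₃ c₄ p₂ p₃ m₄ a b c d →
      a * (c₂ * c₃ * c₄) + (b * (p₂ * c₃ * c₄) + (c * (p₃ * c₄) + (d * m₄ + 0)))
        ≡ d * m₄ + (c * p₃ + (b * p₂ + a * c₂) * c₃) * c₄
    expand = solve-∀

  split₄ : ∀ a b c d L → dot (a ∷ b ∷ c ∷ d ∷ []) g ≡ L * c₄ →
           ∃[ t ] d ≡ t * c₄ × t * m₄ + value₃ a b c ≡ L
  split₄ a b c d L e = coprime-split c₄⊥m₄ d (value₃ a b c) L (trans (sym (horner a b c d)) e)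

  split₃ : ∀ a b c L → value₃ a b c ≡ L * c₃ → ∃[ t ] c ≡ t * c₃ × t * p₃ + value₂ a b ≡ L
  split₃ a b c = coprime-split c₃⊥p₃ c (value₂ a b)

  split₂ : ∀ a b L → value₂ a b ≡ L * c₂ → ∃[ t ] b ≡ t * c₂ × t * p₂ + a ≡ L
  split₂ a b = coprime-split c₂⊥p₂ b a

  absorb-m₄ : ∀ t a b c →
              t * m₄ + value₃ a b c ≡ value₃ (a + t * x₄₁) (b + t * x₄₂) (c + t * x₄₃)
  absorb-m₄ t a b c = distrib t a b c x₄₁ x₄₂ x₄₃ p₂ c₂ c₃ p₃
    where
    distrib : ∀ t a b c x₄₁ x₄₂ x₄₃ p₂ c₂ c₃ p₃ →
      t * (x₄₃ * p₃ + (x₄₂ * p₂ + x₄₁ * c₂) * c₃) + (c * p₃ + (b * p₂ + a * c₂) * c₃)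
        ≡ (c + t * x₄₃) * p₃ + ((b + t * x₄₂) * p₂ + (a + t * x₄₁) * c₂) * c₃
    distrib = solve-∀

  absorb-p₃ : ∀ t a b → t * p₃ + value₂ a b ≡ value₂ (a + t * x₃₁) (b + t * x₃₂)
  absorb-p₃ t a b = distrib t a b x₃₁ x₃₂ p₂ c₂
    where
    distrib : ∀ t a b x₃₁ x₃₂ p₂ c₂ →
      t * (x₃₂ * p₂ + x₃₁ * c₂) + (b * p₂ + a * c₂) ≡ (b + t * x₃₂) * p₂ + (a + t * x₃₁) * c₂
    distrib = solve-∀

  value₂≡0⇒ : ∀ {a b} → value₂ a b ≡ 0 → a ≡ 0 × b ≡ 0
  value₂≡0⇒ {a} {b} e =
    m*n≡0⇒m≡0 a c₂ (m+n≡0⇒n≡0 (b * p₂) e) , m*n≡0⇒m≡0 b p₂ (m+n≡0⇒m≡0 (b * p₂) e)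

  value₃≡0⇒ : ∀ {a b c} → value₃ a b c ≡ 0 → a ≡ 0 × b ≡ 0 × c ≡ 0
  value₃≡0⇒ {a} {b} {c} e =
    let a≡0 , b≡0 = value₂≡0⇒ (m*n≡0⇒m≡0 (value₂ a b) c₃ (m+n≡0⇒n≡0 (c * p₃) e))
    in a≡0 , b≡0 , m*n≡0⇒m≡0 c p₃ (m+n≡0⇒m≡0 (c * p₃) e)

  isolated₄ : ∀ {a b c d} → dot (a ∷ b ∷ c ∷ d ∷ []) g ≡ c₄ * n₄ → d ≢ 0 → a ≡ 0 × b ≡ 0 × c ≡ 0
  isolated₄ {a} {b} {c} {d} e d≢0 with split₄ a b c d m₄ (trans e (*-comm c₄ m₄))
  ... | t , d≡tc₄ , e₄ with q*p+k≡p⇒q≡0⊎k≡0 t m₄ _ e₄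
  ... | inj₁ refl = ⊥-elim (d≢0 d≡tc₄)
  ... | inj₂ v₃≡0 = value₃≡0⇒ v₃≡0

  isolated₃ : ∀ {a b c d} → dot (a ∷ b ∷ c ∷ d ∷ []) g ≡ c₃ * n₃ → c + d ≢ 0 → a ≡ 0 × b ≡ 0
  isolated₃ {a} {b} {c} {d} e c+d≢0
    with split₄ a b c d (p₃ * c₃) (trans e (reorder c₃ p₃ c₄))
    where
    reorder : ∀ c₃ p₃ c₄ → c₃ * (p₃ * c₄) ≡ p₃ * c₃ * c₄
    reorder = solve-∀
  ... | t₄ , d≡t₄c₄ , e₄
    with split₃ (a + t₄ * x₄₁) (b + t₄ * x₄₂) (c + t₄ * x₄₃) p₃ (trans (sym (absorb-m₄ t₄ a b c)) e₄)
  ... | t₃ , c′≡t₃c₃ , e₃ with q*p+k≡p⇒q≡0⊎k≡0 t₃ p₃ _ e₃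
  ... | inj₂ v₂′≡0 = let a′≡0 , b′≡0 = value₂≡0⇒ v₂′≡0 in m+n≡0⇒m≡0 a a′≡0 , m+n≡0⇒m≡0 b b′≡0
  ... | inj₁ refl = ⊥-elim (c+d≢0 (cong₂ _+_ c≡0 d≡0))
    where
    c≡0 : c ≡ 0
    c≡0 = m+n≡0⇒m≡0 c c′≡t₃c₃
    d≡0 : d ≡ 0
    d≡0 = trans d≡t₄c₄ (cong (_* c₄) (m*n≡0⇒m≡0 t₄ x₄₃ (m+n≡0⇒n≡0 c c′≡t₃c₃)))

  isolated₂ : ∀ {a b c d} → dot (a ∷ b ∷ c ∷ d ∷ []) g ≡ c₂ * n₂ → b + (c + d) ≢ 0 → a ≡ 0
  isolated₂ {a} {b} {c} {d} e b+c+d≢0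
    with split₄ a b c d (p₂ * c₂ * c₃) (trans e (reorder c₂ c₃ c₄ p₂))
    where
    reorder : ∀ c₂ c₃ c₄ p₂ → c₂ * (p₂ * c₃ * c₄) ≡ p₂ * c₂ * c₃ * c₄
    reorder = solve-∀
  ... | t₄ , d≡t₄c₄ , e₄
    with split₃ (a + t₄ * x₄₁) (b + t₄ * x₄₂) (c + t₄ * x₄₃) (p₂ * c₂) (trans (sym (absorb-m₄ t₄ a b c)) e₄)
  ... | t₃ , c′≡t₃c₃ , e₃
    with split₂ (a + t₄ * x₄₁ + t₃ * x₃₁) (b + t₄ * x₄₂ + t₃ * x₃₂) p₂
                (trans (sym (absorb-p₃ t₃ (a + t₄ * x₄₁) (b + t₄ * x₄₂))) e₃)
  ... | t₂ , b″≡t₂c₂ , e₂ with q*p+k≡p⇒q≡0⊎k≡0 t₂ p₂ _ e₂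
  ... | inj₂ a″≡0 = m+n≡0⇒m≡0 a (m+n≡0⇒m≡0 (a + t₄ * x₄₁) a″≡0)
  ... | inj₁ refl = ⊥-elim (b+c+d≢0 (cong₂ _+_ b≡0 (cong₂ _+_ c≡0 d≡0)))
    where
    b≡0 : b ≡ 0
    b≡0 = m+n≡0⇒m≡0 b (m+n≡0⇒m≡0 (b + t₄ * x₄₂) b″≡t₂c₂)
    t₃≡0 : t₃ ≡ 0
    t₃≡0 = m*n≡0⇒m≡0 t₃ x₃₂ (m+n≡0⇒n≡0 (b + t₄ * x₄₂) b″≡t₂c₂)
    c′≡0 : c + t₄ * x₄₃ ≡ 0
    c′≡0 = trans c′≡t₃c₃ (cong (_* c₃) t₃≡0)
    c≡0 : c ≡ 0
    c≡0 = m+n≡0⇒m≡0 c c′≡0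
    d≡0 : d ≡ 0
    d≡0 = trans d≡t₄c₄ (cong (_* c₄) (m*n≡0⇒m≡0 t₄ x₄₃ (m+n≡0⇒n≡0 c c′≡0)))

  -- c_i copies of n_i, and the expression of c_i n_i in n₁, …, n_{i-1}.
  e₂ b₂ e₃ b₃ e₄ b₄ : ℕ⁴
  e₂ = 0 ∷ c₂ ∷ 0 ∷ 0 ∷ []
  b₂ = p₂ ∷ 0 ∷ 0 ∷ 0 ∷ []
  e₃ = 0 ∷ 0 ∷ c₃ ∷ 0 ∷ []
  b₃ = x₃₁ ∷ x₃₂ ∷ 0 ∷ 0 ∷ []
  e₄ = 0 ∷ 0 ∷ 0 ∷ c₄ ∷ []
  b₄ = x₄₁ ∷ x₄₂ ∷ x₄₃ ∷ 0 ∷ []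

  e₂↦ : dot e₂ g ≡ c₂ * n₂
  e₂↦ = +-identityʳ (c₂ * n₂)

  e₃↦ : dot e₃ g ≡ c₃ * n₃
  e₃↦ = +-identityʳ (c₃ * n₃)

  e₄↦ : dot e₄ g ≡ c₄ * n₄
  e₄↦ = +-identityʳ (c₄ * n₄)

  b₂↦ : dot b₂ g ≡ c₂ * n₂
  b₂↦ = relation c₂ c₃ c₄ p₂
    where
    relation : ∀ c₂ c₃ c₄ p₂ → p₂ * (c₂ * c₃ * c₄) + 0 ≡ c₂ * (p₂ * c₃ * c₄)
    relation = solve-∀

  b₃↦ : dot b₃ g ≡ c₃ * n₃
  b₃↦ = relation c₂ c₃ c₄ p₂ x₃₁ x₃₂
    where
    relation : ∀ c₂ c₃ c₄ p₂ x₃₁ x₃₂ →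
      x₃₁ * (c₂ * c₃ * c₄) + (x₃₂ * (p₂ * c₃ * c₄) + 0) ≡ c₃ * ((x₃₂ * p₂ + x₃₁ * c₂) * c₄)
    relation = solve-∀

  b₄↦ : dot b₄ g ≡ c₄ * n₄
  b₄↦ = relation c₂ c₃ c₄ p₂ p₃ x₄₁ x₄₂ x₄₃
    where
    relation : ∀ c₂ c₃ c₄ p₂ p₃ x₄₁ x₄₂ x₄₃ →
      x₄₁ * (c₂ * c₃ * c₄) + (x₄₂ * (p₂ * c₃ * c₄) + (x₄₃ * (p₃ * c₄) + 0))
        ≡ c₄ * (x₄₃ * p₃ + (x₄₂ * p₂ + x₄₁ * c₂) * c₃)
    relation = solve-∀

  Touches₂ Touches₃ Touches₄ : ℕ⁴ → Set
  Touches₂ (_ ∷ b ∷ c ∷ d ∷ []) = b + (c + d) ≢ 0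
  Touches₃ (_ ∷ _ ∷ c ∷ d ∷ []) = c + d ≢ 0
  Touches₄ (_ ∷ _ ∷ _ ∷ d ∷ []) = d ≢ 0

  private
    orthogonal : ∀ a b c d a′ b′ c′ d′ → a * a′ ≡ 0 → b * b′ ≡ 0 → c * c′ ≡ 0 → d * d′ ≡ 0 →
                 dot (a ∷ b ∷ c ∷ d ∷ []) (a′ ∷ b′ ∷ c′ ∷ d′ ∷ []) ≡ 0
    orthogonal _ _ _ _ _ _ _ _ p q r t rewrite p | q | r | t = refl

    ≡0⇒*≡0 : ∀ {x} y → x ≡ 0 → x * y ≡ 0
    ≡0⇒*≡0 y refl = refl

    *≡0⇐≡0 : ∀ x {y} → y ≡ 0 → x * y ≡ 0
    *≡0⇐≡0 x refl = *-zeroʳ x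

  touches₂ : ∀ {u v} → Link′ g (c₂ * n₂) u v → Touches₂ u → Touches₂ v
  touches₂ {a ∷ b ∷ c ∷ d ∷ []} {a′ ∷ b′ ∷ c′ ∷ d′ ∷ []} (u↦ , _ , u·v≢0) tu e =
    u·v≢0 (orthogonal a b c d a′ b′ c′ d′
      (≡0⇒*≡0 a′ (isolated₂ {a} {b} {c} {d} u↦ tu)) (*≡0⇐≡0 b b′≡0) (*≡0⇐≡0 c c′≡0) (*≡0⇐≡0 d d′≡0))
    where
    b′≡0 : b′ ≡ 0
    b′≡0 = m+n≡0⇒m≡0 b′ e
    c′≡0 : c′ ≡ 0
    c′≡0 = m+n≡0⇒m≡0 c′ (m+n≡0⇒n≡0 b′ e)
    d′≡0 : d′ ≡ 0
    d′≡0 = m+n≡0⇒n≡0 c′ (m+n≡0⇒n≡0 b′ e)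

  touches₃ : ∀ {u v} → Link′ g (c₃ * n₃) u v → Touches₃ u → Touches₃ v
  touches₃ {a ∷ b ∷ c ∷ d ∷ []} {a′ ∷ b′ ∷ c′ ∷ d′ ∷ []} (u↦ , _ , u·v≢0) tu e =
    let a≡0 , b≡0 = isolated₃ {a} {b} {c} {d} u↦ tu
    in u·v≢0 (orthogonal a b c d a′ b′ c′ d′
         (≡0⇒*≡0 a′ a≡0) (≡0⇒*≡0 b′ b≡0) (*≡0⇐≡0 c (m+n≡0⇒m≡0 c′ e)) (*≡0⇐≡0 d (m+n≡0⇒n≡0 c′ e)))

  touches₄ : ∀ {u v} → Link′ g (c₄ * n₄) u v → Touches₄ u → Touches₄ v
  touches₄ {a ∷ b ∷ c ∷ d ∷ []} {a′ ∷ b′ ∷ c′ ∷ d′ ∷ []} (u↦ , _ , u·v≢0) tu d′≡0 =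
    let a≡0 , b≡0 , c≡0 = isolated₄ {a} {b} {c} {d} u↦ tu
    in u·v≢0 (orthogonal a b c d a′ b′ c′ d′
         (≡0⇒*≡0 a′ a≡0) (≡0⇒*≡0 b′ b≡0) (≡0⇒*≡0 c′ c≡0) (*≡0⇐≡0 d d′≡0))

  betti₂ : IsBetti′ g (c₂ * n₂)
  betti₂ = e₂ , b₂ , e₂↦ , b₂↦ ,
    λ (_ , _ , e₂⟶*b₂) →
      Star-preserves Touches₂ touches₂ e₂⟶*b₂ (≢-nonZero⁻¹ c₂ ∘ trans (sym (+-identityʳ c₂))) refl

  betti₃ : IsBetti′ g (c₃ * n₃)
  betti₃ = e₃ , b₃ , e₃↦ , b₃↦ ,
    λ (_ , _ , e₃⟶*b₃) →
      Star-preserves Touches₃ touches₃ e₃⟶*b₃ (≢-nonZero⁻¹ c₃ ∘ trans (sym (+-identityʳ c₃))) refl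

  betti₄ : IsBetti′ g (c₄ * n₄)
  betti₄ = e₄ , b₄ , e₄↦ , b₄↦ ,
    λ (_ , _ , e₄⟶*b₄) → Star-preserves Touches₄ touches₄ e₄⟶*b₄ (≢-nonZero⁻¹ c₄) refl

  second third fourth : ℕ⁴ → ℕ
  second (_ ∷ b ∷ _ ∷ _ ∷ []) = b
  third  (_ ∷ _ ∷ c ∷ _ ∷ []) = c
  fourth (_ ∷ _ ∷ _ ∷ d ∷ []) = d

  NormalForm : ℕ⁴ → Set
  NormalForm u = second u < c₂ × third u < c₃ × fourth u < c₄

  normal-form-unique : ∀ u v → dot u g ≡ dot v g → NormalForm u → NormalForm v → u ≡ v
  normal-form-unique (a ∷ b ∷ c ∷ d ∷ []) (a′ ∷ b′ ∷ c′ ∷ d′ ∷ []) e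
                     (b<c₂ , c<c₃ , d<c₄) (b′<c₂ , c′<c₃ , d′<c₄)
    with digit-unique c₄⊥m₄ (value₃ a b c) (value₃ a′ b′ c′) d<c₄ d′<c₄
                      (trans (sym (horner a b c d)) (trans e (horner a′ b′ c′ d′)))
  ... | refl , v₃≡v₃′ with digit-unique c₃⊥p₃ (value₂ a b) (value₂ a′ b′) c<c₃ c′<c₃ v₃≡v₃′
  ... | refl , v₂≡v₂′ with digit-unique c₂⊥p₂ a a′ b<c₂ b′<c₂ v₂≡v₂′
  ... | refl , refl = refl

  module _ {s : ℕ} (s≢β₂ : s ≢ c₂ * n₂) (s≢β₃ : s ≢ c₃ * n₃) (s≢β₄ : s ≢ c₄ * n₄) where

    private
      _⟶_ _⟶*_ : ℕ⁴ → ℕ⁴ → Set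
      _⟶_ = Link′ g s
      _⟶*_ = Star _⟶_

      carry₄ : ∀ u → dot u g ≡ s → fourth u < c₄ ⊎ ∃[ v ] (u ⟶ v × dot v g ≡ s × fourth v < fourth u)
      carry₄ (a ∷ b ∷ c ∷ d ∷ []) u↦s with d <? c₄
      ... | yes d<c₄ = inj₁ d<c₄
      ... | no d≮c₄ with m≤n⇒∃[o]m+o≡n (≮⇒≥ d≮c₄)
      ... | r , refl = inj₂ (b₄ +ᵛ w , link , proj₁ (proj₂ link) , m<n+m r (>-nonZero⁻¹ c₄))
        where
        w : ℕ⁴
        w = a ∷ b ∷ c ∷ r ∷ []
        link : (e₄ +ᵛ w) ⟶ (b₄ +ᵛ w)
        link = exchange-link g e₄ b₄ w (trans e₄↦ (sym b₄↦)) u↦s (s≢β₄ ∘ flip trans e₄↦)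

      carry₃ : ∀ u → dot u g ≡ s × fourth u < c₄ →
               third u < c₃ ⊎ ∃[ v ] (u ⟶ v × (dot v g ≡ s × fourth v < c₄) × third v < third u)
      carry₃ (a ∷ b ∷ c ∷ d ∷ []) (u↦s , d<c₄) with c <? c₃
      ... | yes c<c₃ = inj₁ c<c₃
      ... | no c≮c₃ with m≤n⇒∃[o]m+o≡n (≮⇒≥ c≮c₃)
      ... | r , refl = inj₂ (b₃ +ᵛ w , link , (proj₁ (proj₂ link) , d<c₄) , m<n+m r (>-nonZero⁻¹ c₃))
        where
        w : ℕ⁴
        w = a ∷ b ∷ r ∷ d ∷ []
        link : (e₃ +ᵛ w) ⟶ (b₃ +ᵛ w)
        link = exchange-link g e₃ b₃ w (trans e₃↦ (sym b₃↦)) u↦s (s≢β₃ ∘ flip trans e₃↦)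

      carry₂ : ∀ u → dot u g ≡ s × third u < c₃ × fourth u < c₄ →
               second u < c₂ ⊎
               ∃[ v ] (u ⟶ v × (dot v g ≡ s × third v < c₃ × fourth v < c₄) × second v < second u)
      carry₂ (a ∷ b ∷ c ∷ d ∷ []) (u↦s , c<c₃ , d<c₄) with b <? c₂
      ... | yes b<c₂ = inj₁ b<c₂
      ... | no b≮c₂ with m≤n⇒∃[o]m+o≡n (≮⇒≥ b≮c₂)
      ... | r , refl =
        inj₂ (b₂ +ᵛ w , link , (proj₁ (proj₂ link) , c<c₃ , d<c₄) , m<n+m r (>-nonZero⁻¹ c₂))
        where
        w : ℕ⁴
        w = a ∷ r ∷ c ∷ d ∷ []
        link : (e₂ +ᵛ w) ⟶ (b₂ +ᵛ w)
        link = exchange-link g e₂ b₂ w (trans e₂↦ (sym b₂↦)) u↦s (s≢β₂ ∘ flip trans e₂↦)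

    normalise : ∀ u → dot u g ≡ s → ∃[ v ] (u ⟶* v × dot v g ≡ s × NormalForm v)
    normalise u u↦s with descend _ _ fourth carry₄ u u↦s
    ... | v₄ , u⟶*v₄ , v₄↦s , d<c₄ with descend _ _ third carry₃ v₄ (v₄↦s , d<c₄)
    ... | v₃ , v₄⟶*v₃ , (v₃↦s , d₃<c₄) , c<c₃ with descend _ _ second carry₂ v₃ (v₃↦s , c<c₃ , d₃<c₄)
    ... | v , v₃⟶*v , (v↦s , c′<c₃ , d′<c₄) , b<c₂ =
      v , u⟶*v₄ ◅◅ v₄⟶*v₃ ◅◅ v₃⟶*v , v↦s , b<c₂ , c′<c₃ , d′<c₄

    connected : ∀ u v → dot u g ≡ s → dot v g ≡ s → R′ g s u v
    connected u v u↦s v↦s with normalise u u↦s | normalise v v↦s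
    ... | w , u⟶*w , w↦s , nf | w′ , v⟶*w′ , w′↦s , nf′
      with normal-form-unique w w′ (trans w↦s (sym w′↦s)) nf nf′
    ... | refl = u↦s , v↦s , u⟶*w ◅◅ reverse (λ {x y} → Link′-sym g s {x} {y}) v⟶*w′

  betti : ∀ s → IsBetti′ g s ⇔ (s ≡ c₂ * n₂ ⊎ s ≡ c₃ * n₃ ⊎ s ≡ c₄ * n₄)
  betti s = mk⇔ betti⇒ betti⇐
    where
    betti⇐ : ∀ {s} → s ≡ c₂ * n₂ ⊎ s ≡ c₃ * n₃ ⊎ s ≡ c₄ * n₄ → IsBetti′ g s
    betti⇐ (inj₁ refl)        = betti₂
    betti⇐ (inj₂ (inj₁ refl)) = betti₃
    betti⇐ (inj₂ (inj₂ refl)) = betti₄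

    betti⇒ : IsBetti′ g s → s ≡ c₂ * n₂ ⊎ s ≡ c₃ * n₃ ⊎ s ≡ c₄ * n₄
    betti⇒ (u , v , u↦s , v↦s , ¬u~v) with s ≟ c₂ * n₂ | s ≟ c₃ * n₃ | s ≟ c₄ * n₄
    ... | yes s≡β₂ | _ | _ = inj₁ s≡β₂
    ... | no _ | yes s≡β₃ | _ = inj₂ (inj₁ s≡β₃)
    ... | no _ | no _ | yes s≡β₄ = inj₂ (inj₂ s≡β₄)
    ... | no s≢β₂ | no s≢β₃ | no s≢β₄ = ⊥-elim (¬u~v (connected s≢β₂ s≢β₃ s≢β₄ u v u↦s v↦s))

TelescopicPresentation : ℕ⁴ → Set
TelescopicPresentation g = Σ[ T ∈ Telescopic ] g ≡ Telescopic.generators T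

betti-of : ∀ {h₁ h₂ h₃ h₄} → ((T , _) : TelescopicPresentation (h₁ ∷ h₂ ∷ h₃ ∷ h₄ ∷ [])) →
           ∀ s → IsBetti′ (h₁ ∷ h₂ ∷ h₃ ∷ h₄ ∷ []) s ⇔
                 (s ≡ Telescopic.c₂ T * h₂ ⊎ s ≡ Telescopic.c₃ T * h₃ ⊎ s ≡ Telescopic.c₄ T * h₄)
betti-of (T , refl) = TelescopicBetti.betti T

-- Coordinate permutations

record DotIsometry : Set where
  field
    to from : ℕ⁴ → ℕ⁴
    from-to : ∀ u → from (to u) ≡ u
    to-from : ∀ u → to (from u) ≡ u
    dot-to  : ∀ u v → dot (to u) (to v) ≡ dot u v

  dot-from : ∀ u v → dot (from u) (from v) ≡ dot u v
  dot-from u v = trans (sym (dot-to (from u) (from v))) (cong₂ dot (to-from u) (to-from v))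

  inverse : DotIsometry
  inverse = record
    { to = from ; from = to ; from-to = to-from ; to-from = from-to ; dot-to = dot-from }

IsBetti′-to : (σ : DotIsometry) → ∀ {g s} → IsBetti′ g s → IsBetti′ (DotIsometry.to σ g) s
IsBetti′-to σ {g} {s} (u , v , u↦s , v↦s , ¬u~v) =
  to u , to v , trans (dot-to u g) u↦s , trans (dot-to v g) v↦s ,
  λ (_ , _ , σu⟶*σv) →
    ¬u~v (u↦s , v↦s , subst₂ (Star (Link′ g s)) (from-to u) (from-to v) (gmap from link-from σu⟶*σv))
  where
  open DotIsometry σ
  from↦ : ∀ x → dot (from x) g ≡ dot x (to g)
  from↦ x = trans (sym (dot-to (from x) g)) (cong (λ y → dot y (to g)) (to-from x))
  link-from : ∀ {x y} → Link′ (to g) s x y → Link′ g s (from x) (from y)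
  link-from {x} {y} (x↦s , y↦s , x·y≢0) =
    trans (from↦ x) x↦s , trans (from↦ y) y↦s , x·y≢0 ∘ trans (sym (dot-from x y))

IsBetti′-⇔ : (σ : DotIsometry) → ∀ g s → IsBetti′ g s ⇔ IsBetti′ (DotIsometry.to σ g) s
IsBetti′-⇔ σ g s = mk⇔ (IsBetti′-to σ)
  (subst (λ h → IsBetti′ h s) (DotIsometry.from-to σ g) ∘ IsBetti′-to (DotIsometry.inverse σ))

reversal : DotIsometry
reversal = record
  { to = rev ; from = rev ; from-to = involutive ; to-from = involutive ; dot-to = dot-rev }
  where
  rev : ℕ⁴ → ℕ⁴
  rev (a ∷ b ∷ c ∷ d ∷ []) = d ∷ c ∷ b ∷ a ∷ []
  involutive : ∀ u → rev (rev u) ≡ u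
  involutive (a ∷ b ∷ c ∷ d ∷ []) = refl
  dot-rev : ∀ u v → dot (rev u) (rev v) ≡ dot u v
  dot-rev (a ∷ b ∷ c ∷ d ∷ []) (a′ ∷ b′ ∷ c′ ∷ d′ ∷ []) = reorder (a * a′) (b * b′) (c * c′) (d * d′)
    where
    reorder : ∀ x y z t → t + (z + (y + (x + 0))) ≡ x + (y + (z + (t + 0)))
    reorder = solve-∀

rotation : DotIsometry
rotation = record
  { to = rot ; from = rot⁻¹ ; from-to = rot⁻¹-rot ; to-from = rot-rot⁻¹ ; dot-to = dot-rot }
  where
  rot rot⁻¹ : ℕ⁴ → ℕ⁴
  rot   (a ∷ b ∷ c ∷ d ∷ []) = b ∷ c ∷ a ∷ d ∷ []
  rot⁻¹ (a ∷ b ∷ c ∷ d ∷ []) = c ∷ a ∷ b ∷ d ∷ []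
  rot⁻¹-rot : ∀ u → rot⁻¹ (rot u) ≡ u
  rot⁻¹-rot (a ∷ b ∷ c ∷ d ∷ []) = refl
  rot-rot⁻¹ : ∀ u → rot (rot⁻¹ u) ≡ u
  rot-rot⁻¹ (a ∷ b ∷ c ∷ d ∷ []) = refl
  dot-rot : ∀ u v → dot (rot u) (rot v) ≡ dot u v
  dot-rot (a ∷ b ∷ c ∷ d ∷ []) (a′ ∷ b′ ∷ c′ ∷ d′ ∷ []) = reorder (a * a′) (b * b′) (c * c′) (d * d′)
    where
    reorder : ∀ x y z t → y + (z + (x + (t + 0))) ≡ x + (y + (z + (t + 0)))
    reorder = solve-∀

[1+m]C2 : ∀ m → 2 * ((1 + m) C 2) ≡ (1 + m) * m
[1+m]C2 zero    = refl
[1+m]C2 (suc m) = begin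
  2 * ((2 + m) C 2)                     ≡⟨ cong (2 *_) (nCk+nC[k+1]≡[n+1]C[k+1] (1 + m) 1) ⟨
  2 * ((1 + m) C 1 + (1 + m) C 2)       ≡⟨ *-distribˡ-+ 2 ((1 + m) C 1) ((1 + m) C 2) ⟩
  2 * ((1 + m) C 1) + 2 * ((1 + m) C 2) ≡⟨ cong₂ (λ x y → 2 * x + y) (nC1≡n (1 + m)) ([1+m]C2 m) ⟩
  2 * (1 + m) + (1 + m) * m             ≡⟨ solve [ m ] ⟩
  (2 + m) * (1 + m)                     ∎
  where open ≡-Reasoning

[2+m]C3 : ∀ m → 6 * ((2 + m) C 3) ≡ (2 + m) * (1 + m) * m
[2+m]C3 zero    = refl
[2+m]C3 (suc m) = begin
  6 * ((3 + m) C 3)                               ≡⟨ cong (6 *_) (nCk+nC[k+1]≡[n+1]C[k+1] (2 + m) 2) ⟨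
  6 * ((2 + m) C 2 + (2 + m) C 3)                 ≡⟨ *-distribˡ-+ 6 ((2 + m) C 2) ((2 + m) C 3) ⟩
  6 * ((2 + m) C 2) + 6 * ((2 + m) C 3)           ≡⟨ cong (_+ 6 * ((2 + m) C 3)) (*-assoc 3 2 ((2 + m) C 2)) ⟩
  3 * (2 * ((2 + m) C 2)) + 6 * ((2 + m) C 3)     ≡⟨ cong₂ (λ x y → 3 * x + y) ([1+m]C2 (1 + m)) ([2+m]C3 m) ⟩
  3 * ((2 + m) * (1 + m)) + (2 + m) * (1 + m) * m ≡⟨ solve [ m ] ⟩
  (3 + m) * (2 + m) * (1 + m)                     ∎
  where open ≡-Reasoning

[3+m]C4 : ∀ m → 24 * ((3 + m) C 4) ≡ (3 + m) * (2 + m) * (1 + m) * m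
[3+m]C4 zero    = refl
[3+m]C4 (suc m) = begin
  24 * ((4 + m) C 4)
    ≡⟨ cong (24 *_) (nCk+nC[k+1]≡[n+1]C[k+1] (3 + m) 3) ⟨
  24 * ((3 + m) C 3 + (3 + m) C 4)
    ≡⟨ *-distribˡ-+ 24 ((3 + m) C 3) ((3 + m) C 4) ⟩
  24 * ((3 + m) C 3) + 24 * ((3 + m) C 4)
    ≡⟨ cong (_+ 24 * ((3 + m) C 4)) (*-assoc 4 6 ((3 + m) C 3)) ⟩
  4 * (6 * ((3 + m) C 3)) + 24 * ((3 + m) C 4)
    ≡⟨ cong₂ (λ x y → 4 * x + y) ([2+m]C3 (1 + m)) ([3+m]C4 m) ⟩
  4 * ((3 + m) * (2 + m) * (1 + m)) + (3 + m) * (2 + m) * (1 + m) * m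
    ≡⟨ solve [ m ] ⟩
  (4 + m) * (3 + m) * (2 + m) * (1 + m)
    ∎
  where open ≡-Reasoning

tetrahedral : ∀ m → 6 * TH m ≡ (2 + m) * (1 + m) * m
tetrahedral m = subst (λ k → 6 * (k C 3) ≡ (2 + m) * (1 + m) * m) (+-comm 2 m) ([2+m]C3 m)

[n+[3+j]]C4 : ∀ n j → 24 * ((n + (3 + j)) C 4) ≡ (3 + (n + j)) * (2 + (n + j)) * (1 + (n + j)) * (n + j)
[n+[3+j]]C4 n j =
  subst (λ k → 24 * (k C 4) ≡ (3 + (n + j)) * (2 + (n + j)) * (1 + (n + j)) * (n + j))
        (sym n+[3+j]≡3+[n+j]) ([3+m]C4 (n + j))
  where
  n+[3+j]≡3+[n+j] : n + (3 + j) ≡ 3 + (n + j)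
  n+[3+j]≡3+[n+j] = trans (sym (+-assoc n 3 j)) (cong (_+ j) (+-comm n 3))

-- The hypotheses are explicit polynomial identities, to be discharged by the ring solver; coprimality
-- to p₃ and m₄ may be established for any number equal to them, typically a product of factors.
tetrahedral-presentation : ∀ m₁ m₂ m₃ m₄ c₂ c₃ c₄ p₂ x₃₁ x₃₂ x₄₁ x₄₂ x₄₃ →
  ⦃ _ : NonZero c₂ ⦄ ⦃ _ : NonZero c₃ ⦄ ⦃ _ : NonZero c₄ ⦄ →
  ⦃ _ : NonZero p₂ ⦄ ⦃ _ : NonZero x₃₂ ⦄ ⦃ _ : NonZero x₄₃ ⦄ →
  (2 + m₁) * (1 + m₁) * m₁ ≡ 6 * (c₂ * c₃ * c₄) →
  (2 + m₂) * (1 + m₂) * m₂ ≡ 6 * (p₂ * c₃ * c₄) →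
  (2 + m₃) * (1 + m₃) * m₃ ≡ 6 * ((x₃₂ * p₂ + x₃₁ * c₂) * c₄) →
  (2 + m₄) * (1 + m₄) * m₄ ≡ 6 * (x₄₃ * (x₃₂ * p₂ + x₃₁ * c₂) + (x₄₂ * p₂ + x₄₁ * c₂) * c₃) →
  ∀ {q₃ q₄} → Coprime c₂ p₂ →
  Coprime c₃ q₃ → q₃ ≡ x₃₂ * p₂ + x₃₁ * c₂ →
  Coprime c₄ q₄ → q₄ ≡ x₄₃ * (x₃₂ * p₂ + x₃₁ * c₂) + (x₄₂ * p₂ + x₄₁ * c₂) * c₃ →
  TelescopicPresentation (TH m₁ ∷ TH m₂ ∷ TH m₃ ∷ TH m₄ ∷ [])
tetrahedral-presentation m₁ m₂ m₃ m₄ c₂ c₃ c₄ p₂ x₃₁ x₃₂ x₄₁ x₄₂ x₄₃ e₁ e₂ e₃ e₄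
                         c₂⊥p₂ c₃⊥q₃ q₃≡p₃ c₄⊥q₄ q₄≡m₄ = T , generators≡
  where
  T : Telescopic
  T = record
    { c₂ = c₂ ; c₃ = c₃ ; c₄ = c₄ ; p₂ = p₂ ; x₃₁ = x₃₁ ; x₃₂ = x₃₂ ; x₄₁ = x₄₁ ; x₄₂ = x₄₂ ; x₄₃ = x₄₃
    ; c₂⊥p₂ = c₂⊥p₂ ; c₃⊥p₃ = subst (Coprime c₃) q₃≡p₃ c₃⊥q₃ ; c₄⊥m₄ = subst (Coprime c₄) q₄≡m₄ c₄⊥q₄ }
  TH-≡ : ∀ m x → (2 + m) * (1 + m) * m ≡ 6 * x → TH m ≡ x
  TH-≡ m x e = *-cancelˡ-≡ (TH m) x 6 (trans (tetrahedral m) e)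
  generators≡ : TH m₁ ∷ TH m₂ ∷ TH m₃ ∷ TH m₄ ∷ [] ≡ Telescopic.generators T
  generators≡ = cong₂ _∷_ (TH-≡ m₁ _ e₁) (cong₂ _∷_ (TH-≡ m₂ _ e₂)
                  (cong₂ _∷_ (TH-≡ m₃ _ e₃) (cong₂ _∷_ (TH-≡ m₄ _ e₄) refl)))

private
  TH-multiple : ∀ k c m a n j →
    4 * (k * (c * ((2 + m) * (1 + m) * m))) ≡ a * ((3 + (n + j)) * (2 + (n + j)) * (1 + (n + j)) * (n + j)) →
    k * (c * TH m) ≡ a * ((n + (3 + j)) C 4)
  TH-multiple k c m a n j e = *-cancelˡ-≡ _ _ 24 (begin
    24 * (k * (c * TH m))                                          ≡⟨ regroup k c (TH m) ⟩
    4 * (k * (c * (6 * TH m)))                                     ≡⟨ cong (λ x → 4 * (k * (c * x))) (tetrahedral m) ⟩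
    4 * (k * (c * ((2 + m) * (1 + m) * m)))                        ≡⟨ e ⟩
    a * ((3 + (n + j)) * (2 + (n + j)) * (1 + (n + j)) * (n + j)) ≡⟨ cong (a *_) ([n+[3+j]]C4 n j) ⟨
    a * (24 * ((n + (3 + j)) C 4))                                 ≡⟨ swap a ((n + (3 + j)) C 4) ⟩
    24 * (a * ((n + (3 + j)) C 4))                                 ∎)
    where
    open ≡-Reasoning
    regroup : ∀ k c t → 24 * (k * (c * t)) ≡ 4 * (k * (c * (6 * t)))
    regroup = solve-∀
    swap : ∀ a x → a * (24 * x) ≡ 24 * (a * x)
    swap = solve-∀

multiple-⇔ : ∀ c m a n j →
  4 * (c * ((2 + m) * (1 + m) * m)) ≡ a * ((3 + (n + j)) * (2 + (n + j)) * (1 + (n + j)) * (n + j)) →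
  ∀ s → (s ≡ c * TH m) ⇔ (s ≡ a * ((n + (3 + j)) C 4))
multiple-⇔ c m a n j e s = mk⇔ (λ s≡β → trans s≡β β≡) (λ s≡aC → trans s≡aC (sym β≡))
  where
  β≡ : c * TH m ≡ a * ((n + (3 + j)) C 4)
  β≡ = trans (sym (*-identityˡ (c * TH m)))
             (TH-multiple 1 c m a n j (trans (cong (4 *_) (*-identityˡ (c * ((2 + m) * (1 + m) * m)))) e))

four-thirds-⇔ : ∀ c m n j →
  3 * (c * ((2 + m) * (1 + m) * m)) ≡ (3 + (n + j)) * (2 + (n + j)) * (1 + (n + j)) * (n + j) →
  ∀ s → (s ≡ c * TH m) ⇔ FourThirds s ((n + (3 + j)) C 4)
four-thirds-⇔ c m n j e s =
  mk⇔ (λ { refl → 3β≡ }) (λ 3s≡4C → *-cancelˡ-≡ s (c * TH m) 3 (trans 3s≡4C (sym 3β≡)))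
  where
  3β≡ : 3 * (c * TH m) ≡ 4 * ((n + (3 + j)) C 4)
  3β≡ = TH-multiple 3 c m 4 n j (cong (4 *_) e)

⊎-reverse : ∀ {A B C : Set} → (A ⊎ B ⊎ C) ⇔ (C ⊎ B ⊎ A)
⊎-reverse = mk⇔ mirror mirror
  where
  mirror : ∀ {A B C : Set} → A ⊎ B ⊎ C → C ⊎ B ⊎ A
  mirror (inj₁ a)        = inj₂ (inj₂ a)
  mirror (inj₂ (inj₁ b)) = inj₂ (inj₁ b)
  mirror (inj₂ (inj₂ c)) = inj₁ c

⊎-rotateʳ : ∀ {A B C : Set} → (A ⊎ B ⊎ C) ⇔ (C ⊎ A ⊎ B)
⊎-rotateʳ = mk⇔ rotateʳ rotateˡ
  where
  rotateʳ : ∀ {A B C : Set} → A ⊎ B ⊎ C → C ⊎ A ⊎ B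
  rotateʳ (inj₁ a)        = inj₂ (inj₁ a)
  rotateʳ (inj₂ (inj₁ b)) = inj₂ (inj₂ b)
  rotateʳ (inj₂ (inj₂ c)) = inj₁ c
  rotateˡ : ∀ {A B C : Set} → C ⊎ A ⊎ B → A ⊎ B ⊎ C
  rotateˡ (inj₁ c)        = inj₂ (inj₂ c)
  rotateˡ (inj₂ (inj₁ a)) = inj₁ a
  rotateˡ (inj₂ (inj₂ b)) = inj₂ (inj₁ b)

-- The six residues of n modulo 6

presentation-6k : ∀ v → TelescopicPresentation (gens (6 * suc v))
presentation-6k v = tetrahedral-presentation (6 * suc v) (6 * suc v + 1) (6 * suc v + 2) (6 * suc v + 3)
  (2 + 2 * v) (7 + 6 * v) (4 + 3 * v) (3 + 2 * v) (9 + 6 * v) 4 (3 + 2 * v) (3 + v) 2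
  (solve [ v ]) (solve [ v ]) (solve [ v ]) (solve [ v ])
  (Bézout⇒coprime′ (2 + 2 * v) (3 + 2 * v) 1 1 (solve [ v ]))
  (coprime-*ʳ (Bézout⇒coprime (7 + 6 * v) (3 + 2 * v) (1 + v) (2 + 3 * v) (solve [ v ]))
              (Bézout⇒coprime (7 + 6 * v) (10 + 6 * v) (3 + 2 * v) (2 + 2 * v) (solve [ v ])))
  (solve [ v ])
  (coprime-*ʳ (coprime-*ʳ (Bézout⇒coprime′ (4 + 3 * v) (3 + 2 * v) 2 3 (solve [ v ]))
                          (Bézout⇒coprime′ (4 + 3 * v) (5 + 3 * v) 1 1 (solve [ v ])))
              (Bézout⇒coprime (4 + 3 * v) (11 + 6 * v) (3 + 2 * v) (1 + v) (solve [ v ])))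
  (solve [ v ])

betti-6k : ∀ k → 4 ≤ 6 * k → ∀ s → IsBetti (6 * k) s ⇔
  (s ≡ 2 * ((6 * k + 5) C 4) ⊎ s ≡ 4 * ((6 * k + 4) C 4) ⊎ FourThirds s ((6 * k + 3) C 4))
betti-6k zero ()
betti-6k (suc v) _ s = ⇔.trans (betti-of (presentation-6k v) s) (⇔.trans
  (four-thirds-⇔ (2 + 2 * v) (6 * suc v + 1) (6 * suc v) 0 (solve [ v ]) s ⊎-⇔
   multiple-⇔ (7 + 6 * v) (6 * suc v + 2) 4 (6 * suc v) 1 (solve [ v ]) s ⊎-⇔
   multiple-⇔ (4 + 3 * v) (6 * suc v + 3) 2 (6 * suc v) 2 (solve [ v ]) s)
  ⊎-reverse)

presentation-6k+1 : ∀ v → TelescopicPresentation (gens (6 * suc v + 1))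
presentation-6k+1 v = tetrahedral-presentation
  (6 * suc v + 1) (6 * suc v + 1 + 1) (6 * suc v + 1 + 2) (6 * suc v + 1 + 3)
  (7 + 6 * v) (4 + 3 * v) (3 + 2 * v) (10 + 6 * v) (5 + 3 * v) 2 0 0 (4 + 2 * v)
  (solve [ v ]) (solve [ v ]) (solve [ v ]) (solve [ v ])
  (Bézout⇒coprime (7 + 6 * v) (10 + 6 * v) (3 + 2 * v) (2 + 2 * v) (solve [ v ]))
  (coprime-*ʳ (Bézout⇒coprime′ (4 + 3 * v) (5 + 3 * v) 1 1 (solve [ v ]))
              (Bézout⇒coprime (4 + 3 * v) (11 + 6 * v) (3 + 2 * v) (1 + v) (solve [ v ])))
  (solve [ v ])
  (coprime-*ʳ (coprime-*ʳ (Bézout⇒coprime′ (3 + 2 * v) (5 + 3 * v) 3 2 (solve [ v ]))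
                          (Bézout⇒coprime (3 + 2 * v) (11 + 6 * v) (4 + 3 * v) (1 + v) (solve [ v ])))
              (Bézout⇒coprime′ (3 + 2 * v) (4 + 2 * v) 1 1 (solve [ v ])))
  (solve [ v ])

betti-6k+1 : ∀ k → 4 ≤ 6 * k + 1 → ∀ s → IsBetti (6 * k + 1) s ⇔
  (FourThirds s ((6 * k + 1 + 5) C 4) ⊎ s ≡ 2 * ((6 * k + 1 + 4) C 4) ⊎ s ≡ 4 * ((6 * k + 1 + 3) C 4))
betti-6k+1 zero (s≤s ())
betti-6k+1 (suc v) _ s = ⇔.trans (betti-of (presentation-6k+1 v) s) (⇔.trans
  (multiple-⇔ (7 + 6 * v) (6 * suc v + 1 + 1) 4 (6 * suc v + 1) 0 (solve [ v ]) s ⊎-⇔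
   multiple-⇔ (4 + 3 * v) (6 * suc v + 1 + 2) 2 (6 * suc v + 1) 1 (solve [ v ]) s ⊎-⇔
   four-thirds-⇔ (3 + 2 * v) (6 * suc v + 1 + 3) (6 * suc v + 1) 2 (solve [ v ]) s)
  ⊎-reverse)

presentation-6k+2 : ∀ v → TelescopicPresentation (gens (6 * suc v + 2))
presentation-6k+2 v = tetrahedral-presentation
  (6 * suc v + 2) (6 * suc v + 2 + 1) (6 * suc v + 2 + 2) (6 * suc v + 2 + 3)
  (8 + 6 * v) (3 + 2 * v) (5 + 3 * v) (11 + 6 * v) 0 (4 + 2 * v) 0 (6 + 3 * v) 2
  (solve [ v ]) (solve [ v ]) (solve [ v ]) (solve [ v ])
  (Bézout⇒coprime′ (8 + 6 * v) (11 + 6 * v) (4 + 2 * v) (3 + 2 * v) (solve [ v ]))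
  (coprime-*ʳ (Bézout⇒coprime (3 + 2 * v) (11 + 6 * v) (4 + 3 * v) (1 + v) (solve [ v ]))
              (Bézout⇒coprime′ (3 + 2 * v) (4 + 2 * v) 1 1 (solve [ v ])))
  (solve [ v ])
  (coprime-*ʳ (coprime-*ʳ (Bézout⇒coprime′ (5 + 3 * v) (11 + 6 * v) 2 1 (solve [ v ]))
                          (Bézout⇒coprime′ (5 + 3 * v) (2 + v) 1 3 (solve [ v ])))
              (Bézout⇒coprime′ (5 + 3 * v) (13 + 6 * v) (5 + 2 * v) (2 + v) (solve [ v ])))
  (solve [ v ])

betti-6k+2 : ∀ k → 4 ≤ 6 * k + 2 → ∀ s → IsBetti (6 * k + 2) s ⇔
  (s ≡ 2 * ((6 * k + 2 + 5) C 4) ⊎ FourThirds s ((6 * k + 2 + 4) C 4) ⊎ s ≡ 4 * ((6 * k + 2 + 3) C 4))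
betti-6k+2 zero (s≤s (s≤s ()))
betti-6k+2 (suc v) _ s = ⇔.trans (betti-of (presentation-6k+2 v) s) (⇔.trans
  (multiple-⇔ (8 + 6 * v) (6 * suc v + 2 + 1) 4 (6 * suc v + 2) 0 (solve [ v ]) s ⊎-⇔
   four-thirds-⇔ (3 + 2 * v) (6 * suc v + 2 + 2) (6 * suc v + 2) 1 (solve [ v ]) s ⊎-⇔
   multiple-⇔ (5 + 3 * v) (6 * suc v + 2 + 3) 2 (6 * suc v + 2) 2 (solve [ v ]) s)
  ⊎-reverse)

presentation-6k+3 : ∀ v → TelescopicPresentation (gens (6 * suc v + 3))
presentation-6k+3 v = tetrahedral-presentation
  (6 * suc v + 3) (6 * suc v + 3 + 1) (6 * suc v + 3 + 2) (6 * suc v + 3 + 3)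
  (3 + 2 * v) (5 + 3 * v) (11 + 6 * v) (4 + 2 * v) (2 + v) (5 + 2 * v) (4 + 2 * v) (10 + 4 * v) 4
  (solve [ v ]) (solve [ v ]) (solve [ v ]) (solve [ v ])
  (Bézout⇒coprime′ (3 + 2 * v) (4 + 2 * v) 1 1 (solve [ v ]))
  (coprime-*ʳ (Bézout⇒coprime′ (5 + 3 * v) (2 + v) 1 3 (solve [ v ]))
              (Bézout⇒coprime′ (5 + 3 * v) (13 + 6 * v) (5 + 2 * v) (2 + v) (solve [ v ])))
  (solve [ v ])
  (coprime-*ʳ (coprime-*ʳ (Bézout⇒coprime′ (11 + 6 * v) (2 + v) 1 6 (solve [ v ]))
                          (Bézout⇒coprime (11 + 6 * v) (13 + 6 * v) (6 + 3 * v) (5 + 3 * v) (solve [ v ])))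
              (Bézout⇒coprime′ (11 + 6 * v) (14 + 6 * v) (5 + 2 * v) (4 + 2 * v) (solve [ v ])))
  (solve [ v ])

betti-6k+3 : ∀ k → 4 ≤ 6 * k + 3 → ∀ s → IsBetti (6 * k + 3) s ⇔
  (s ≡ 4 * ((6 * k + 3 + 5) C 4) ⊎ s ≡ 2 * ((6 * k + 3 + 4) C 4) ⊎ FourThirds s ((6 * k + 3 + 3) C 4))
betti-6k+3 zero (s≤s (s≤s (s≤s ())))
betti-6k+3 (suc v) _ s = ⇔.trans (betti-of (presentation-6k+3 v) s) (⇔.trans
  (four-thirds-⇔ (3 + 2 * v) (6 * suc v + 3 + 1) (6 * suc v + 3) 0 (solve [ v ]) s ⊎-⇔
   multiple-⇔ (5 + 3 * v) (6 * suc v + 3 + 2) 2 (6 * suc v + 3) 1 (solve [ v ]) s ⊎-⇔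
   multiple-⇔ (11 + 6 * v) (6 * suc v + 3 + 3) 4 (6 * suc v + 3) 2 (solve [ v ]) s)
  ⊎-reverse)

presentation-6k+4 : ∀ k → TelescopicPresentation (DotIsometry.to reversal (gens (6 * k + 4)))
presentation-6k+4 k = tetrahedral-presentation
  (6 * k + 4 + 3) (6 * k + 4 + 2) (6 * k + 4 + 1) (6 * k + 4)
  (3 + 2 * k) (4 + 3 * k) (7 + 6 * k) (2 + 2 * k) (1 + k) (1 + 2 * k) 0 0 (4 + 6 * k)
  (solve [ k ]) (solve [ k ]) (solve [ k ]) (solve [ k ])
  (Bézout⇒coprime (3 + 2 * k) (2 + 2 * k) 1 1 (solve [ k ]))
  (coprime-*ʳ (Bézout⇒coprime′ (4 + 3 * k) (5 + 6 * k) (1 + 2 * k) (1 + k) (solve [ k ]))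
              (Bézout⇒coprime (4 + 3 * k) (1 + k) 1 3 (solve [ k ])))
  (solve [ k ])
  (coprime-*ʳ (coprime-*ʳ (Bézout⇒coprime′ (7 + 6 * k) (4 + 6 * k) (1 + 2 * k) (2 + 2 * k) (solve [ k ]))
                          (Bézout⇒coprime′ (7 + 6 * k) (5 + 6 * k) (2 + 3 * k) (3 + 3 * k) (solve [ k ])))
              (Bézout⇒coprime (7 + 6 * k) (1 + k) 1 6 (solve [ k ])))
  (solve [ k ])

betti-6k+4 : ∀ k s → IsBetti (6 * k + 4) s ⇔
  (FourThirds s ((6 * k + 4 + 5) C 4) ⊎ s ≡ 2 * ((6 * k + 4 + 4) C 4) ⊎ s ≡ 4 * ((6 * k + 4 + 3) C 4))
betti-6k+4 k s =
  ⇔.trans (IsBetti′-⇔ reversal (gens (6 * k + 4)) s) (⇔.trans (betti-of (presentation-6k+4 k) s)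
  (four-thirds-⇔ (3 + 2 * k) (6 * k + 4 + 2) (6 * k + 4) 2 (solve [ k ]) s ⊎-⇔
   multiple-⇔ (4 + 3 * k) (6 * k + 4 + 1) 2 (6 * k + 4) 1 (solve [ k ]) s ⊎-⇔
   multiple-⇔ (7 + 6 * k) (6 * k + 4) 4 (6 * k + 4) 0 (solve [ k ]) s))

presentation-6k+5 : ∀ k → TelescopicPresentation (DotIsometry.to rotation (gens (6 * k + 5)))
presentation-6k+5 k = tetrahedral-presentation
  (6 * k + 5 + 1) (6 * k + 5 + 2) (6 * k + 5) (6 * k + 5 + 3)
  (2 + 2 * k) (4 + 3 * k) (7 + 6 * k) (3 + 2 * k) (1 + 2 * k) (1 + k) 4 4 (8 + 6 * k)
  (solve [ k ]) (solve [ k ]) (solve [ k ]) (solve [ k ])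
  (Bézout⇒coprime′ (2 + 2 * k) (3 + 2 * k) 1 1 (solve [ k ]))
  (coprime-*ʳ (Bézout⇒coprime′ (4 + 3 * k) (5 + 6 * k) (1 + 2 * k) (1 + k) (solve [ k ]))
              (Bézout⇒coprime (4 + 3 * k) (1 + k) 1 3 (solve [ k ])))
  (solve [ k ])
  (coprime-*ʳ (coprime-*ʳ (Bézout⇒coprime′ (7 + 6 * k) (4 + 3 * k) 1 2 (solve [ k ]))
                          (Bézout⇒coprime (7 + 6 * k) (3 + 2 * k) (1 + k) (2 + 3 * k) (solve [ k ])))
              (Bézout⇒coprime (7 + 6 * k) (10 + 6 * k) (3 + 2 * k) (2 + 2 * k) (solve [ k ])))
  (solve [ k ])

betti-6k+5 : ∀ k s → IsBetti (6 * k + 5) s ⇔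
  (s ≡ 4 * ((6 * k + 5 + 5) C 4) ⊎ FourThirds s ((6 * k + 5 + 4) C 4) ⊎ s ≡ 2 * ((6 * k + 5 + 3) C 4))
betti-6k+5 k s =
  ⇔.trans (IsBetti′-⇔ rotation (gens (6 * k + 5)) s) (⇔.trans (betti-of (presentation-6k+5 k) s) (⇔.trans
  (four-thirds-⇔ (2 + 2 * k) (6 * k + 5 + 2) (6 * k + 5) 1 (solve [ k ]) s ⊎-⇔
   multiple-⇔ (4 + 3 * k) (6 * k + 5) 2 (6 * k + 5) 0 (solve [ k ]) s ⊎-⇔
   multiple-⇔ (7 + 6 * k) (6 * k + 5 + 3) 4 (6 * k + 5) 2 (solve [ k ]) s)
  ⊎-rotateʳ))

corollary34 : (n k : ℕ) → 4 ≤ n →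
    (n ≡ 6 * k → ∀ s → IsBetti n s ⇔
       (s ≡ 2 * ((n + 5) C 4) ⊎ s ≡ 4 * ((n + 4) C 4) ⊎ FourThirds s ((n + 3) C 4)))
    × (n ≡ 6 * k + 1 → ∀ s → IsBetti n s ⇔
       (FourThirds s ((n + 5) C 4) ⊎ s ≡ 2 * ((n + 4) C 4) ⊎ s ≡ 4 * ((n + 3) C 4)))
    × (n ≡ 6 * k + 2 → ∀ s → IsBetti n s ⇔
       (s ≡ 2 * ((n + 5) C 4) ⊎ FourThirds s ((n + 4) C 4) ⊎ s ≡ 4 * ((n + 3) C 4)))
    × (n ≡ 6 * k + 3 → ∀ s → IsBetti n s ⇔
       (s ≡ 4 * ((n + 5) C 4) ⊎ s ≡ 2 * ((n + 4) C 4) ⊎ FourThirds s ((n + 3) C 4)))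
    × (n ≡ 6 * k + 4 → ∀ s → IsBetti n s ⇔
       (FourThirds s ((n + 5) C 4) ⊎ s ≡ 2 * ((n + 4) C 4) ⊎ s ≡ 4 * ((n + 3) C 4)))
    × (n ≡ 6 * k + 5 → ∀ s → IsBetti n s ⇔
       (s ≡ 4 * ((n + 5) C 4) ⊎ FourThirds s ((n + 4) C 4) ⊎ s ≡ 2 * ((n + 3) C 4)))
corollary34 n k 4≤n =
  (λ { refl → betti-6k k 4≤n }) , (λ { refl → betti-6k+1 k 4≤n }) , (λ { refl → betti-6k+2 k 4≤n }) ,
  (λ { refl → betti-6k+3 k 4≤n }) , (λ { refl → betti-6k+4 k }) , (λ { refl → betti-6k+5 k })
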